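{- Let $A$ be an ASM that classically avoids $3412$, and suppose $A_{i_a,j_a}=A_{i_b,j_b}=-1$ with $i_a<i_b$ and $j_a<j_b$. Let $P_1$ be the set of entries on the lattice path from $(i_a,j_a)$ to $(i_b,j_b)$ consisting of east steps $(0,1)$ followed by south steps $(1,0)$ (i.e. positions $(i_a,j)$ for $j_a\le j\le j_b$ and $(i,j_b)$ for $i_a\le i\le i_b$), and let $P_2$ be the set of entries on the path consisting of south steps followed by east steps (positions $(i,j_a)$ for $i_a\le i\le i_b$ and $(i_b,j)$ for $j_a\le j\le j_b$). Then $A$ has an entry equal to $1$ in at least one of $P_1$, $P_2$.
   Context: An alternating sign matrix (ASM) is a square matrix with entries in $\{0,1,-1\}$ such that every row and every column sums to $1$ and the nonzero entries of each row and each column alternate in sign. A permutation $\pi\in S_k$ is identified with the $k\times k$ matrix whose row $i$ has a $1$ in column $\pi(i)$ and $0$ elsewhere. An $n\times n$ ASM $A$ classically contains $\pi\in S_k$ if there are order-preserving injections $f,g:[k]\to[n]$ with $A_{f(i),g(\pi(i))}=1$ for all $i$; otherwise $A$ classically avoids $\pi$. -}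

module Defs where

open import Data.Nat using (ℕ; suc)
open import Data.Fin using (Fin; zero; suc; _<_; _≤_)
open import Data.Integer using (ℤ; +_; -_; -1ℤ; 0ℤ; 1ℤ)
open import Data.Product using (Σ; ∃; _×_; _,_)
open import Data.Sum using (_⊎_)
open import Relation.Binary.PropositionalEquality using (_≡_; _≢_)
open import Relation.Nullary using (¬_)
open import Data.Vec.Functional using (Vector; foldr)
import Data.Integer as ℤ

Matrix : ℕ → Set
Matrix n = Fin n → Fin n → ℤ

sumV : ∀ {n} → Vector ℤ n → ℤ
sumV = foldr ℤ._+_ 0ℤ

-- entries of a vector alternate in sign: whenever v j and v j' are nonzero,
-- j < j', and every entry strictly between them is zero, they have opposite signs
-- (for entries in {0,1,-1}: one is 1 and the other is -1, i.e. they are different)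
Alternating : ∀ {n} → Vector ℤ n → Set
Alternating {n} v = ∀ (j j' : Fin n) → j < j' → v j ≢ 0ℤ → v j' ≢ 0ℤ →
  (∀ (l : Fin n) → j < l → l < j' → v l ≡ 0ℤ) → v j ≢ v j'

record IsASM {n : ℕ} (A : Matrix n) : Set where
  field
    entries : ∀ i j → A i j ≡ 0ℤ ⊎ A i j ≡ 1ℤ ⊎ A i j ≡ -1ℤ
    rowSum  : ∀ i → sumV (λ j → A i j) ≡ 1ℤ
    colSum  : ∀ j → sumV (λ i → A i j) ≡ 1ℤ
    rowAlt  : ∀ i → Alternating (λ j → A i j)
    colAlt  : ∀ j → Alternating (λ i → A i j)

OrderPreserving : ∀ {k n} → (Fin k → Fin n) → Set
OrderPreserving {k} f = ∀ (a b : Fin k) → a < b → f a < f b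

record Perm (k : ℕ) : Set where
  field
    π    : Fin k → Fin k
    π⁻¹  : Fin k → Fin k
    invˡ : ∀ x → π⁻¹ (π x) ≡ x
    invʳ : ∀ x → π (π⁻¹ x) ≡ x

ClassicallyContains : ∀ {n k} → Matrix n → Perm k → Set
ClassicallyContains {n} {k} A σ =
  Σ (Fin k → Fin n) λ f → Σ (Fin k → Fin n) λ g →
    OrderPreserving f × OrderPreserving g ×
    (∀ i → A (f i) (g (Perm.π σ i)) ≡ 1ℤ)

ClassicallyAvoids : ∀ {n k} → Matrix n → Perm k → Set
ClassicallyAvoids A σ = ¬ ClassicallyContains A σ

-- the permutation 3412 (one-line notation, 0-indexed: 0↦2, 1↦3, 2↦0, 3↦1)
p3412-fun : Fin 4 → Fin 4
p3412-fun zero = suc (suc zero)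
p3412-fun (suc zero) = suc (suc (suc zero))
p3412-fun (suc (suc zero)) = zero
p3412-fun (suc (suc (suc zero))) = suc zero

p3412-inv : ∀ x → p3412-fun (p3412-fun x) ≡ x
p3412-inv zero = Relation.Binary.PropositionalEquality.refl
p3412-inv (suc zero) = Relation.Binary.PropositionalEquality.refl
p3412-inv (suc (suc zero)) = Relation.Binary.PropositionalEquality.refl
p3412-inv (suc (suc (suc zero))) = Relation.Binary.PropositionalEquality.refl

p3412 : Perm 4
p3412 = record { π = p3412-fun ; π⁻¹ = p3412-fun ; invˡ = p3412-inv ; invʳ = p3412-inv }

InP1 : ∀ {n} → (ia ja ib jb : Fin n) → Fin n → Fin n → Set
InP1 ia ja ib jb i j = (i ≡ ia × ja ≤ j × j ≤ jb) ⊎ (j ≡ jb × ia ≤ i × i ≤ ib)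

InP2 : ∀ {n} → (ia ja ib jb : Fin n) → Fin n → Fin n → Set
InP2 ia ja ib jb i j = (j ≡ ja × ia ≤ i × i ≤ ib) ⊎ (i ≡ ib × ja ≤ j × j ≤ jb)

-- Every -1 in a row or column of an ASM has a 1 on each side of it. Take a 1
-- right of (ia, ja) in row ia, one below it in column ja, one above (ib, jb) in
-- column jb and one left of it in row ib. If none of the four lies on P1 or P2,
-- they overshoot the rectangle on all four sides, and read off in row order
-- their columns are ranked 3, 4, 1, 2: an occurrence of 3412.
module Submission where

open import Defs
open import Data.Nat using (ℕ; zero; suc; z<s; s<s)
open import Data.Nat.Properties using (<⇒≤; ≰⇒>)
open import Data.Fin using (Fin; _<_) renaming (zero to fz; suc to fs)
open import Data.Fin.Properties using (any?; _<?_; _≤?_; <-trans)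
open import Data.Integer using (ℤ; -_; -1ℤ; 0ℤ; 1ℤ; _+_)
open import Data.Integer.Properties using (_≟_; +-identityˡ; +-identityʳ; +-inverseˡ; neg-injective)
open import Data.Product using (Σ; ∃-syntax; _×_; _,_)
open import Data.Sum using (_⊎_; inj₁; inj₂)
open import Data.Empty using (⊥-elim)
open import Relation.Nullary using (yes; no)
open import Relation.Nullary.Decidable using (_×-dec_)
open import Relation.Binary.PropositionalEquality using (_≡_; _≢_; refl; sym; trans; cong; cong₂)
open import Data.Vec.Functional using (Vector; tail; []; _∷_)

SignEntry : ℤ → Set
SignEntry x = x ≡ 0ℤ ⊎ x ≡ 1ℤ ⊎ x ≡ -1ℤ

nonzero-signs-distinct⇒opposite : ∀ {x y} → SignEntry x → SignEntry y →
  x ≢ 0ℤ → y ≢ 0ℤ → x ≢ y → y ≡ - x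
nonzero-signs-distinct⇒opposite (inj₁ refl)        _                  x≢0 _   _   = ⊥-elim (x≢0 refl)
nonzero-signs-distinct⇒opposite _                  (inj₁ refl)        _   y≢0 _   = ⊥-elim (y≢0 refl)
nonzero-signs-distinct⇒opposite (inj₂ (inj₁ refl)) (inj₂ (inj₁ refl)) _   _   x≢y = ⊥-elim (x≢y refl)
nonzero-signs-distinct⇒opposite (inj₂ (inj₁ refl)) (inj₂ (inj₂ refl)) _   _   _   = refl
nonzero-signs-distinct⇒opposite (inj₂ (inj₂ refl)) (inj₂ (inj₁ refl)) _   _   _   = refl
nonzero-signs-distinct⇒opposite (inj₂ (inj₂ refl)) (inj₂ (inj₂ refl)) _   _   x≢y = ⊥-elim (x≢y refl)

-1≢0 : -1ℤ ≢ 0ℤ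
-1≢0 ()

1≢0 : 1ℤ ≢ 0ℤ
1≢0 ()

1≢-1 : 1ℤ ≢ -1ℤ
1≢-1 ()

record IsAlternatingSignVector {n} (v : Vector ℤ n) : Set where
  field
    signs       : ∀ j → SignEntry (v j)
    alternating : Alternating v

open IsAlternatingSignVector

tail-isAlternatingSignVector : ∀ {n} {v : Vector ℤ (suc n)} →
  IsAlternatingSignVector v → IsAlternatingSignVector (tail v)
tail-isAlternatingSignVector {v = v} asv = record
  { signs       = λ j → signs asv (fs j)
  ; alternating = λ j j' j<j' vj≢0 vj'≢0 between →
      alternating asv (fs j) (fs j') (s<s j<j') vj≢0 vj'≢0 (shift between)
  }
  where
  shift : ∀ {j j'} → (∀ l → j < l → l < j' → tail v l ≡ 0ℤ) →
          ∀ l → fs j < l → l < fs j' → v l ≡ 0ℤ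
  shift between (fs l) (s<s j<l) (s<s l<j') = between l j<l l<j'

row-isAlternatingSignVector : ∀ {n} {A : Matrix n} → IsASM A → ∀ i →
  IsAlternatingSignVector (λ j → A i j)
row-isAlternatingSignVector asm i =
  record { signs = IsASM.entries asm i ; alternating = IsASM.rowAlt asm i }

column-isAlternatingSignVector : ∀ {n} {A : Matrix n} → IsASM A → ∀ j →
  IsAlternatingSignVector (λ i → A i j)
column-isAlternatingSignVector asm j =
  record { signs = λ i → IsASM.entries asm i j ; alternating = IsASM.colAlt asm j }

-- The first nonzero entry, or 0 for the zero vector.
leadingEntry : ∀ {n} → Vector ℤ n → ℤ
leadingEntry {zero}  v = 0ℤ
leadingEntry {suc n} v with v fz ≟ 0ℤ
... | yes _ = leadingEntry (tail v)
... | no  _ = v fz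

leadingEntry-position : ∀ {n} (v : Vector ℤ n) → leadingEntry v ≢ 0ℤ →
  ∃[ k ] v k ≡ leadingEntry v × (∀ l → l < k → v l ≡ 0ℤ)
leadingEntry-position {zero}  v ≢0 = ⊥-elim (≢0 refl)
leadingEntry-position {suc n} v ≢0 with v fz ≟ 0ℤ
... | no  _    = fz , refl , λ _ ()
... | yes v0≡0 with leadingEntry-position (tail v) ≢0
...   | k , vk≡ , before = fs k , vk≡ , λ { fz _ → v0≡0 ; (fs l) (s<s l<k) → before l l<k }

leadingEntry-tail : ∀ {n} {v : Vector ℤ (suc n)} → IsAlternatingSignVector v →
  v fz ≢ 0ℤ → leadingEntry (tail v) ≢ 0ℤ → v fz ≡ - leadingEntry (tail v)
leadingEntry-tail {n} {v} asv v0≢0 lt≢0 with leadingEntry-position (tail v) lt≢0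
... | k , vk≡lt , before = trans
  (nonzero-signs-distinct⇒opposite (signs asv (fs k)) (signs asv fz) vk≢0 v0≢0
    (λ vk≡v0 → alternating asv fz (fs k) z<s v0≢0 vk≢0 between (sym vk≡v0)))
  (cong -_ vk≡lt)
  where
  vk≢0 : v (fs k) ≢ 0ℤ
  vk≢0 vk≡0 = lt≢0 (trans (sym vk≡lt) vk≡0)
  between : ∀ l → fz {n} < l → l < fs k → v l ≡ 0ℤ
  between (fs l) _ (s<s l<k) = before l l<k

-- The nonzero entries cancel in pairs.
sum-isAlternatingSignVector : ∀ {n} {v : Vector ℤ n} → IsAlternatingSignVector v →
  sumV v ≡ 0ℤ ⊎ sumV v ≡ leadingEntry v
sum-isAlternatingSignVector {zero} _ = inj₁ refl
sum-isAlternatingSignVector {suc n} {v} asv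
  with v fz ≟ 0ℤ | sum-isAlternatingSignVector (tail-isAlternatingSignVector asv)
... | yes v0≡0 | ih rewrite v0≡0 | +-identityˡ (sumV (tail v)) = ih
... | no  _    | inj₁ s≡0 rewrite s≡0 = inj₂ (+-identityʳ (v fz))
... | no  v0≢0 | inj₂ s≡lt with leadingEntry (tail v) ≟ 0ℤ
...   | yes lt≡0 rewrite s≡lt | lt≡0 = inj₂ (+-identityʳ (v fz))
...   | no  lt≢0 rewrite s≡lt | leadingEntry-tail asv v0≢0 lt≢0 =
  inj₁ (+-inverseˡ (leadingEntry (tail v)))

leadingEntry≡-1 : ∀ {n} {v : Vector ℤ n} → (∀ j → SignEntry (v j)) →
  ∀ j → v j ≡ -1ℤ → (∀ l → l < j → v l ≢ 1ℤ) → leadingEntry v ≡ -1ℤ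
leadingEntry≡-1 {v = v} _ fz v0≡-1 _ with v fz ≟ 0ℤ
... | yes v0≡0 = ⊥-elim (-1≢0 (trans (sym v0≡-1) v0≡0))
... | no  _    = v0≡-1
leadingEntry≡-1 {v = v} signs (fs j) vj≡-1 no1 with v fz ≟ 0ℤ | signs fz
... | yes _ | _ = leadingEntry≡-1 (λ l → signs (fs l)) j vj≡-1 (λ l l<j → no1 (fs l) (s<s l<j))
... | no v0≢0 | inj₁ v0≡0        = ⊥-elim (v0≢0 v0≡0)
... | no _    | inj₂ (inj₁ v0≡1) = ⊥-elim (no1 fz z<s v0≡1)
... | no _    | inj₂ (inj₂ v0≡-1) = v0≡-1

sum-tail≡0-after-final-minusOne : ∀ {n} {v : Vector ℤ (suc n)} → IsAlternatingSignVector v →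
  v fz ≡ -1ℤ → (∀ l → fz {n} < l → v l ≢ 1ℤ) → sumV (tail v) ≡ 0ℤ
sum-tail≡0-after-final-minusOne {v = v} asv v0≡-1 no1
  with sum-isAlternatingSignVector (tail-isAlternatingSignVector asv)
... | inj₁ s≡0  = s≡0
... | inj₂ s≡lt = trans s≡lt tailLeading≡0
  where
  v0≢0 : v fz ≢ 0ℤ
  v0≢0 v0≡0 = -1≢0 (trans (sym v0≡-1) v0≡0)
  tailLeading≡0 : leadingEntry (tail v) ≡ 0ℤ
  tailLeading≡0 with leadingEntry (tail v) ≟ 0ℤ
  ... | yes lt≡0 = lt≡0
  ... | no  lt≢0 with leadingEntry-position (tail v) lt≢0
  ...   | k , vk≡lt , _ = ⊥-elim (no1 (fs k) z<s (trans vk≡lt lt≡1))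
    where
    lt≡1 : leadingEntry (tail v) ≡ 1ℤ
    lt≡1 = neg-injective (trans (sym (leadingEntry-tail asv v0≢0 lt≢0)) v0≡-1)

-- The hypotheses say the last nonzero entry is -1; pairing the nonzero entries
-- off from the right leaves either nothing or a leading -1.
sum-ending-in-minusOne : ∀ {n} {v : Vector ℤ n} → IsAlternatingSignVector v →
  ∀ j → v j ≡ -1ℤ → (∀ l → j < l → v l ≢ 1ℤ) →
  (leadingEntry v ≡ 1ℤ × sumV v ≡ 0ℤ) ⊎ (leadingEntry v ≡ -1ℤ × sumV v ≡ -1ℤ)
sum-ending-in-minusOne {suc n} {v} asv fz v0≡-1 no1 with v fz ≟ 0ℤ
... | yes v0≡0 = ⊥-elim (-1≢0 (trans (sym v0≡-1) v0≡0))
... | no  _    = inj₂ (v0≡-1 , cong₂ _+_ v0≡-1 (sum-tail≡0-after-final-minusOne asv v0≡-1 no1))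
sum-ending-in-minusOne {suc n} {v} asv (fs j) vj≡-1 no1
  with v fz ≟ 0ℤ
     | sum-ending-in-minusOne (tail-isAlternatingSignVector asv) j vj≡-1 (λ l j<l → no1 (fs l) (s<s j<l))
... | yes v0≡0 | ih rewrite v0≡0 | +-identityˡ (sumV (tail v)) = ih
... | no  v0≢0 | inj₁ (lt≡1 , s≡0)
  rewrite leadingEntry-tail asv v0≢0 (λ lt≡0 → 1≢0 (trans (sym lt≡1) lt≡0)) | lt≡1 | s≡0
  = inj₂ (refl , refl)
... | no  v0≢0 | inj₂ (lt≡-1 , s≡-1)
  rewrite leadingEntry-tail asv v0≢0 (λ lt≡0 → -1≢0 (trans (sym lt≡-1) lt≡0)) | lt≡-1 | s≡-1
  = inj₁ (refl , refl)

one-before-minusOne : ∀ {n} {v : Vector ℤ n} → IsAlternatingSignVector v → sumV v ≡ 1ℤ →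
  ∀ j → v j ≡ -1ℤ → ∃[ k ] k < j × v k ≡ 1ℤ
one-before-minusOne {v = v} asv sum≡1 j vj≡-1 with any? (λ k → (k <? j) ×-dec (v k ≟ 1ℤ))
... | yes one = one
... | no ¬one with sum-isAlternatingSignVector asv
...   | inj₁ sum≡0 = ⊥-elim (1≢0 (trans (sym sum≡1) sum≡0))
...   | inj₂ sum≡l = ⊥-elim (1≢-1 (trans (sym sum≡1) (trans sum≡l leading≡-1)))
  where
  leading≡-1 : leadingEntry v ≡ -1ℤ
  leading≡-1 = leadingEntry≡-1 (signs asv) j vj≡-1 (λ k k<j vk≡1 → ¬one (k , k<j , vk≡1))

one-after-minusOne : ∀ {n} {v : Vector ℤ n} → IsAlternatingSignVector v → sumV v ≡ 1ℤ →
  ∀ j → v j ≡ -1ℤ → ∃[ k ] j < k × v k ≡ 1ℤ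
one-after-minusOne {v = v} asv sum≡1 j vj≡-1 with any? (λ k → (j <? k) ×-dec (v k ≟ 1ℤ))
... | yes one = one
... | no ¬one with sum-ending-in-minusOne asv j vj≡-1 (λ k j<k vk≡1 → ¬one (k , j<k , vk≡1))
...   | inj₁ (_ , sum≡0)  = ⊥-elim (1≢0 (trans (sym sum≡1) sum≡0))
...   | inj₂ (_ , sum≡-1) = ⊥-elim (1≢-1 (trans (sym sum≡1) sum≡-1))

singleton-orderPreserving : ∀ {n} (a : Fin n) → OrderPreserving (a ∷ [])
singleton-orderPreserving a fz fz ()

∷-orderPreserving : ∀ {k n} {a : Fin n} {f : Vector (Fin n) (suc k)} →
  a < f fz → OrderPreserving f → OrderPreserving (a ∷ f)
∷-orderPreserving a<f0 f↑ fz     fz          ()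
∷-orderPreserving a<f0 f↑ fz     (fs fz)     _         = a<f0
∷-orderPreserving a<f0 f↑ fz     (fs (fs j)) _         = <-trans a<f0 (f↑ fz (fs j) z<s)
∷-orderPreserving a<f0 f↑ (fs i) fz          ()
∷-orderPreserving a<f0 f↑ (fs i) (fs j)      (s<s i<j) = f↑ i j i<j

lemma4p2 : (n : ℕ) (A : Matrix n) → IsASM A → ClassicallyAvoids A p3412 →
    (ia ja ib jb : Fin n) → A ia ja ≡ -1ℤ → A ib jb ≡ -1ℤ → ia < ib → ja < jb →
    (Σ (Fin n) λ i → Σ (Fin n) λ j → InP1 ia ja ib jb i j × A i j ≡ 1ℤ)
    ⊎ (Σ (Fin n) λ i → Σ (Fin n) λ j → InP2 ia ja ib jb i j × A i j ≡ 1ℤ)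
lemma4p2 n A asm avoids ia ja ib jb a≡-1 b≡-1 ia<ib ja<jb
  with one-after-minusOne  (row-isAlternatingSignVector asm ia)    (IsASM.rowSum asm ia) ja a≡-1
     | one-before-minusOne (row-isAlternatingSignVector asm ib)    (IsASM.rowSum asm ib) jb b≡-1
     | one-after-minusOne  (column-isAlternatingSignVector asm ja) (IsASM.colSum asm ja) ia a≡-1
     | one-before-minusOne (column-isAlternatingSignVector asm jb) (IsASM.colSum asm jb) ib b≡-1
... | c , ja<c , ia-c≡1 | c' , c'<jb , ib-c'≡1 | r , ia<r , r-ja≡1 | r' , r'<ib , r'-jb≡1
  with c ≤? jb | r ≤? ib | ia ≤? r' | ja ≤? c'
... | yes c≤jb | _ | _ | _ = inj₁ (ia , c , inj₁ (refl , <⇒≤ ja<c , c≤jb) , ia-c≡1)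
... | no _ | yes r≤ib | _ | _ = inj₂ (r , ja , inj₁ (refl , <⇒≤ ia<r , r≤ib) , r-ja≡1)
... | no _ | no _ | yes ia≤r' | _ = inj₁ (r' , jb , inj₂ (refl , ia≤r' , <⇒≤ r'<ib) , r'-jb≡1)
... | no _ | no _ | no _ | yes ja≤c' = inj₂ (ib , c' , inj₂ (refl , ja≤c' , <⇒≤ c'<jb) , ib-c'≡1)
... | no c≰jb | no r≰ib | no ia≰r' | no ja≰c' =
  ⊥-elim (avoids (rows , columns , rows↑ , columns↑ , occurrence))
  where
  rows columns : Vector (Fin n) 4
  rows    = r' ∷ ia ∷ ib ∷ r ∷ []
  columns = c' ∷ ja ∷ jb ∷ c ∷ []
  rows↑ : OrderPreserving rows
  rows↑ = ∷-orderPreserving (≰⇒> ia≰r') (∷-orderPreserving ia<ib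
            (∷-orderPreserving (≰⇒> r≰ib) (singleton-orderPreserving r)))
  columns↑ : OrderPreserving columns
  columns↑ = ∷-orderPreserving (≰⇒> ja≰c') (∷-orderPreserving ja<jb
               (∷-orderPreserving (≰⇒> c≰jb) (singleton-orderPreserving c)))
  occurrence : ∀ i → A (rows i) (columns (p3412-fun i)) ≡ 1ℤ
  occurrence fz                = r'-jb≡1
  occurrence (fs fz)           = ia-c≡1
  occurrence (fs (fs fz))      = ib-c'≡1
  occurrence (fs (fs (fs fz))) = r-ja≡1
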